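{- Let $M$ be either the K2P or the K3P model. Let $N_1$ be a $k_1$-cycle network and $N_2$ a $k_2$-cycle network on the same leaf set $[n]$, with $2\le k_1<k_2\le 4$. Then $V^M_{N_2}\not\subseteq V^M_{N_1}$.
   Context: A $k$-cycle network on leaf set $[n]$ is a semi-directed network obtained by taking a cycle with $k$ vertices, attaching to every cycle vertex a binary tree with at least one leaf (a single leaf, or a rooted binary tree whose root is joined to the cycle vertex), labelling the leaves bijectively by $[n]$, and designating one cycle vertex as the reticulation vertex; the two cycle edges incident to the reticulation vertex are the reticulation edges $e_1,e_2$. Let $G=\mathbb{Z}_2\times\mathbb{Z}_2$. To each edge $e$ of $N$ and each $g\in G$ associate a complex parameter $a^e_g$. For the K3P model these are unrestricted; for the K2P model one fixes two distinct non-identity elements $h_1,h_2\in G$ and imposes $a^e_{h_1}=a^e_{h_2}$ for every edge $e$. For $i=1,2$ let $T_i$ be the tree obtained from $N$ by deleting $e_i$ (keeping all other edges of $N$, with their parameters); each edge $e$ of $T_i$ induces a split $A_e|B_e$ of $[n]$. Define $\psi_{T_i}$ with coordinates $q_{g_1,\dots,g_n}$, $(g_1,\dots,g_n)\in G^n$, by $q_{g_1,\dots,g_n}=\prod_{e\in E(T_i)}a^e_{\sum_{j\in A_e}g_j}$ if $\sum_{j}g_j=0$ and $0$ otherwise. The network model is $\psi_N=\lambda\psi_{T_1}+(1-\lambda)\psi_{T_2}$, and $V^M_N\subseteq\mathbb{C}^{4^n}$ is the Zariski closure of the image of $\psi_N$ over all parameters $a$ and $\lambda$ (with the restrictions of model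 $M$). -}

module Defs where

open import Level using (0ℓ)
open import Algebra.Bundles using (CommutativeRing)
open import Data.Nat as ℕ using (ℕ; zero; suc; _≤ᵇ_; _<ᵇ_; _∸_)
open import Data.Fin using (Fin; toℕ)
open import Data.Bool using (Bool; true; false; if_then_else_)
open import Data.List as List using (List; []; _∷_; _++_; [_])
open import Data.List.Relation.Binary.Permutation.Propositional using (_↭_)
open import Data.Product using (Σ; ∃; _×_; _,_)
open import Relation.Nullary using (¬_)
open import Relation.Binary.PropositionalEquality using (_≡_; _≢_)

data G : Set where
  e₀ e₁ e₂ e₃ : G   -- e₀ = (0,0), e₁ = (1,0), e₂ = (0,1), e₃ = (1,1)

_⊕_ : G → G → G
e₀ ⊕ h  = h
h  ⊕ e₀ = h
e₁ ⊕ e₁ = e₀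
e₁ ⊕ e₂ = e₃
e₁ ⊕ e₃ = e₂
e₂ ⊕ e₁ = e₃
e₂ ⊕ e₂ = e₀
e₂ ⊕ e₃ = e₁
e₃ ⊕ e₁ = e₂
e₃ ⊕ e₂ = e₁
e₃ ⊕ e₃ = e₀

isZero : G → Bool
isZero e₀ = true
isZero _  = false

sumFin : ∀ {k} → (Fin k → G) → G
sumFin {zero}  f = e₀
sumFin {suc k} f = f Fin.zero ⊕ sumFin (λ i → f (Fin.suc i))
  where import Data.Fin as Fin

data BTree (n : ℕ) : Set where
  leaf : Fin n → BTree n
  node : BTree n → BTree n → BTree n

leaves : ∀ {n} → BTree n → List (Fin n)
leaves (leaf j)   = [ j ]
leaves (node l r) = leaves l ++ leaves r

-- edges of a rooted binary tree (not counting the edge above the root)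
data TEdge {n : ℕ} : BTree n → Set where
  toL : ∀ {l r} → TEdge (node l r)
  toR : ∀ {l r} → TEdge (node l r)
  inL : ∀ {l r} → TEdge l → TEdge (node l r)
  inR : ∀ {l r} → TEdge r → TEdge (node l r)

gsum : ∀ {n} → BTree n → (Fin n → G) → G
gsum (leaf j)   g = g j
gsum (node l r) g = gsum l g ⊕ gsum r g

-- Cycle vertices c₀,…,c_{k-1} (indexed by Fin k); cycle edge j joins c_j and
-- c_{j+1 mod k}.  The reticulation vertex is c₀ (any designation can be
-- rotated to this one), so the reticulation edges are cycle edge 0
-- (c₀–c₁) and cycle edge k-1 (c_{k-1}–c₀).  To cycle vertex i is attached
-- the tree  tree i  (a single leaf, or a rooted binary tree whose root is
-- joined to c_i by the pendant edge).

record CycleNet (n k : ℕ) : Set where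
  field
    tree     : Fin k → BTree n
    bijLeaves : List.concat (List.tabulate (λ i → leaves (tree i))) ↭ List.allFin n

open CycleNet public

data NEdge {n k : ℕ} (N : CycleNet n k) : Set where
  cyc  : Fin k → NEdge N
  pend : Fin k → NEdge N
  int  : (i : Fin k) → TEdge (tree N i) → NEdge N

data Model : Set where
  K3P : Model
  K2P : (h₁ h₂ : G) → h₁ ≢ h₂ → h₁ ≢ e₀ → h₂ ≢ e₀ → Model

-- Algebraically closed fields of characteristic zero
-- (used in place of ℂ)

module _ (R : CommutativeRing 0ℓ 0ℓ) where
  open CommutativeRing R

  natR : ℕ → Carrier
  natR zero    = 0#
  natR (suc m) = 1# + natR m

  evalU : List Carrier → Carrier → Carrier
  evalU []       x = 0#
  evalU (c ∷ cs) x = c + x * evalU cs x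

record IsACF0 (R : CommutativeRing 0ℓ 0ℓ) : Set where
  open CommutativeRing R
  field
    nontrivial : ¬ (1# ≈ 0#)
    inverse    : ∀ x → ¬ (x ≈ 0#) → ∃ λ y → x * y ≈ 1#
    charZero   : ∀ m → ¬ (natR R (suc m) ≈ 0#)
    algClosed  : ∀ (c₀ : Carrier) (cs : List Carrier) (cd : Carrier) → ¬ (cd ≈ 0#) →
                 ∃ λ x → evalU R (c₀ ∷ cs ++ [ cd ]) x ≈ 0#

module Poly (R : CommutativeRing 0ℓ 0ℓ) where
  open CommutativeRing R

  data Pol (V : Set) : Set where
    con  : Carrier → Pol V
    var  : V → Pol V
    _:+_ : Pol V → Pol V → Pol V
    _:*_ : Pol V → Pol V → Pol V

  eval : ∀ {V} → Pol V → (V → Carrier) → Carrier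
  eval (con c)  x = c
  eval (var v)  x = x v
  eval (p :+ q) x = eval p x + eval q x
  eval (p :* q) x = eval p x * eval q x

  prodFin : ∀ {k} → (Fin k → Carrier) → Carrier
  prodFin {zero}  f = 1#
  prodFin {suc k} f = f Fin.zero * prodFin (λ i → f (Fin.suc i))
    where import Data.Fin as Fin

  sumFinIf : ∀ {k} → (Fin k → Bool) → (Fin k → G) → G
  sumFinIf b f = sumFin (λ i → if b i then f i else e₀)

  -- coordinates of 𝔸^{4^n}: indexed by (g₁,…,gₙ) ∈ Gⁿ
  Coord : ℕ → Set
  Coord n = Fin n → G

  Point : ℕ → Set
  Point n = Coord n → Carrier

  Params : ∀ {n k} → CycleNet n k → Set
  Params N = NEdge N → G → Carrier

  Admissible : ∀ {n k} {N : CycleNet n k} → Model → Params N → Set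
  Admissible K3P a = Data.Unit.⊤
    where import Data.Unit
  Admissible (K2P h₁ h₂ _ _ _) a = ∀ e → a e h₁ ≈ a e h₂

  prodT : ∀ {n} (t : BTree n) → (TEdge t → G → Carrier) → (Fin n → G) → Carrier
  prodT (leaf j)   p g = 1#
  prodT (node l r) p g =
    p toL (gsum l g) * p toR (gsum r g) *
    prodT l (λ e → p (inL e)) g * prodT r (λ e → p (inR e)) g

  prodTrees : ∀ {n k} (N : CycleNet n k) → Params N → (Fin n → G) → Carrier
  prodTrees N a g = prodFin (λ i →
    a (pend i) (gsum (tree N i) g) * prodT (tree N i) (λ e → a (int i e)) g)

  -- T₁ : delete cycle edge 0 (c₀–c₁).  The remaining cycle edge j (1 ≤ j ≤ k-1)
  -- has split side A = leaves of the trees at c₁,…,c_j.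
  cycFactor₁ : ∀ {n k} (N : CycleNet n k) → Params N → (Fin n → G) → Carrier
  cycFactor₁ N a g = prodFin (λ j →
    if toℕ j ℕ.≡ᵇ 0 then 1#
    else a (cyc j) (sumFinIf (λ v → (1 ≤ᵇ toℕ v) Data.Bool.∧ (toℕ v ≤ᵇ toℕ j))
                             (λ v → gsum (tree N v) g)))
    where import Data.Bool

  -- T₂ : delete cycle edge k-1 (c_{k-1}–c₀).  The remaining cycle edge j
  -- (0 ≤ j ≤ k-2) has split side A = leaves of the trees at c₀,…,c_j.
  cycFactor₂ : ∀ {n k} (N : CycleNet n k) → Params N → (Fin n → G) → Carrier
  cycFactor₂ {k = k} N a g = prodFin (λ j →
    if suc (toℕ j) ℕ.≡ᵇ k then 1#
    else a (cyc j) (sumFinIf (λ v → toℕ v ≤ᵇ toℕ j) (λ v → gsum (tree N v) g)))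

  ψT₁ : ∀ {n k} (N : CycleNet n k) → Params N → Point n
  ψT₁ N a g = if isZero (sumFin g) then prodTrees N a g * cycFactor₁ N a g else 0#

  ψT₂ : ∀ {n k} (N : CycleNet n k) → Params N → Point n
  ψT₂ N a g = if isZero (sumFin g) then prodTrees N a g * cycFactor₂ N a g else 0#

  ψN : ∀ {n k} (N : CycleNet n k) → Params N → Carrier → Point n
  ψN N a λ' g = λ' * ψT₁ N a g + (1# - λ') * ψT₂ N a g

  -- the variety V^M_N: Zariski closure of the image of ψ_N, i.e. the common
  -- zero set of all polynomials vanishing on that image
  _∈V[_,_] : ∀ {n k} → Point n → Model → CycleNet n k → Set
  x ∈V[ M , N ] =
    ∀ (f : Pol (Coord _)) →
      (∀ (a : Params N) → Admissible M a → ∀ λ' → eval f (ψN N a λ') ≈ 0#) →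
      eval f x ≈ 0#

module Submission where

-- Fix three leaves u₀,u₁,u₂.  A point m = (a,b) of the plane
-- {g₀ ⊕ g₁ ⊕ g₂ = e₀} ⊆ G³ gives the coordinate 'place u m' carrying a, b, a⊕b at
-- u₀, u₁, u₂ and e₀ elsewhere.  For six such points m₁,m₂,m₃ and n₁,n₂,n₃ every
-- linear form G³ → G takes the same multiset of values on the m's and on the n's
-- ('form-balanced'); consider the binomial f = x_{m₁}x_{m₂}x_{m₃} − x_{n₁}x_{n₂}x_{n₃}.
--  (1) Every edge parameter of ψ_N is evaluated at a linear form of m.  If two of
--      the leaves lie in one tree of N₁, the cycle edges of N₁ only see the third
--      coordinate ('pairing'), so f vanishes on the image of ψ_{N₁}
--      ('balanced-on-network').
--  (2) If the u's are leftmost leaves of three trees of N₂ placed suitably around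
--      a cycle edge ('Witness'), the parameters that put the indicator of g ≠ e₀ on
--      that edge and 1 elsewhere give a point of V_{N₂} where f ≠ 0
--      ('probe-separates').
--  (3) As k₁ < k₂, two trees of N₂ have their leftmost leaves in one tree of N₁
--      (pigeonhole), and for k₂ ∈ {3,4} every such pair is covered by a witness.

open import Defs
open import Level using (0ℓ)
open import Algebra.Bundles using (CommutativeRing)
open import Data.Nat as ℕ using (ℕ; zero; suc; _≤_; _<_; s≤s; z≤n; _≤ᵇ_)
import Data.Nat.Properties as ℕₚ
open import Data.Fin as F using (Fin; toℕ; #_) renaming (zero to fz; suc to fs)
open import Data.Fin.Properties using (pigeonhole; all?; suc-injective)
open import Data.Bool using (Bool; true; false; not; _∧_; _xor_; if_then_else_) renaming (_≟_ to _≟B_)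
open import Data.Bool.Properties using (not-distribˡ-xor)
open import Data.List as L using (List; []; _∷_; _++_)
open import Data.List.Relation.Binary.Permutation.Propositional as Perm using (_↭_; ↭-refl; ↭-sym)
open import Data.Vec.Functional using (foldr)
open import Data.Product using (Σ; _×_; _,_; proj₁; proj₂)
open import Function using (_$_; _∘_)
open import Data.Unit using (tt)
open import Relation.Nullary using (¬_; Dec; yes; no; does; contradiction)
open import Relation.Nullary.Decidable using (True; toWitness; map′; from-yes; _×-dec_; _→-dec_; dec-true; dec-false)
open import Relation.Unary using (Decidable)
open import Relation.Binary.Definitions using (DecidableEquality)
open import Relation.Binary.PropositionalEquality as P using (_≡_; _≢_; refl; sym; trans; cong; cong₂; subst)

index : G → Fin 4
index e₀ = fz
index e₁ = fs fz
index e₂ = fs (fs fz)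
index e₃ = fs (fs (fs fz))

index-injective : ∀ {g h} → index g ≡ index h → g ≡ h
index-injective {e₀} {e₀} _ = refl
index-injective {e₁} {e₁} _ = refl
index-injective {e₂} {e₂} _ = refl
index-injective {e₃} {e₃} _ = refl

_≟G_ : DecidableEquality G
g ≟G h = map′ index-injective (cong index) (index g F.≟ index h)

∀G? : ∀ {P : G → Set} → Decidable P → Dec (∀ g → P g)
∀G? P? = map′ (λ { (p₀ , p₁ , p₂ , p₃) → λ { e₀ → p₀ ; e₁ → p₁ ; e₂ → p₂ ; e₃ → p₃ } })
              (λ p → p e₀ , p e₁ , p e₂ , p e₃)
              (P? e₀ ×-dec P? e₁ ×-dec P? e₂ ×-dec P? e₃)

∀Bool? : ∀ {P : Bool → Set} → Decidable P → Dec (∀ b → P b)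
∀Bool? P? = map′ (λ { (p₀ , p₁) → λ { false → p₀ ; true → p₁ } })
                 (λ p → p false , p true)
                 (P? false ×-dec P? true)

⊕-identityʳ : ∀ g → g ⊕ e₀ ≡ g
⊕-identityʳ e₀ = refl
⊕-identityʳ e₁ = refl
⊕-identityʳ e₂ = refl
⊕-identityʳ e₃ = refl

⊕-self : ∀ g → g ⊕ g ≡ e₀
⊕-self e₀ = refl
⊕-self e₁ = refl
⊕-self e₂ = refl
⊕-self e₃ = refl

⊕-medial : ∀ a b c d → (a ⊕ b) ⊕ (c ⊕ d) ≡ (a ⊕ c) ⊕ (b ⊕ d)
⊕-medial = from-yes (∀G? λ a → ∀G? λ b → ∀G? λ c → ∀G? λ d →
                       ((a ⊕ b) ⊕ (c ⊕ d)) ≟G ((a ⊕ c) ⊕ (b ⊕ d)))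

sel : Bool → G → G
sel b g = if b then g else e₀

sel-xor : ∀ b b' g → sel b g ⊕ sel b' g ≡ sel (b xor b') g
sel-xor true  true  g = ⊕-self g
sel-xor true  false g = ⊕-identityʳ g
sel-xor false b'    g = refl

sumFin-cong : ∀ {k} {f h : Fin k → G} → (∀ i → f i ≡ h i) → sumFin f ≡ sumFin h
sumFin-cong {zero}  e = refl
sumFin-cong {suc k} e = cong₂ _⊕_ (e fz) (sumFin-cong (λ i → e (fs i)))

sumFin-⊕ : ∀ {k} (f h : Fin k → G) → sumFin (λ i → f i ⊕ h i) ≡ sumFin f ⊕ sumFin h
sumFin-⊕ {zero}  f h = refl
sumFin-⊕ {suc k} f h =
  trans (cong ((f fz ⊕ h fz) ⊕_) (sumFin-⊕ (λ i → f (fs i)) (λ i → h (fs i))))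
        (⊕-medial (f fz) (h fz) _ _)

sumFin-zero : ∀ {k} → sumFin {k} (λ _ → e₀) ≡ e₀
sumFin-zero {zero}  = refl
sumFin-zero {suc k} = sumFin-zero {k}

sumFin-swap : ∀ {n k} (f : Fin k → Fin n → G) →
              sumFin (λ j → sumFin (λ c → f c j)) ≡ sumFin (λ c → sumFin (λ j → f c j))
sumFin-swap {zero}  {k} f = sym (sumFin-zero {k})
sumFin-swap {suc n} {k} f =
  trans (cong (sumFin (λ c → f c fz) ⊕_) (sumFin-swap (λ c j → f c (fs j))))
        (sym (sumFin-⊕ (λ c → f c fz) (λ c → sumFin (λ j → f c (fs j)))))

sumFin-delta : ∀ {n} (u : Fin n) g → sumFin (λ j → sel (does (u F.≟ j)) g) ≡ g
sumFin-delta {suc n} fz     g = trans (cong (g ⊕_) (sumFin-zero {n})) (⊕-identityʳ g)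
sumFin-delta {suc n} (fs u) g = sumFin-delta u g

-- Points of the plane {g₀ ⊕ g₁ ⊕ g₂ = e₀} ⊆ G³, parametrised by (g₀ , g₁).
Pt : Set
Pt = G × G

coord : Pt → Fin 3 → G
coord (a , b) fz           = a
coord (a , b) (fs fz)      = b
coord (a , b) (fs (fs fz)) = a ⊕ b

∀Pt? : ∀ {P : Pt → Set} → Decidable P → Dec (∀ m → P m)
∀Pt? P? = map′ (λ p (a , b) → p a b) (λ p a b → p (a , b)) (∀G? λ a → ∀G? λ b → P? (a , b))

coord-sum : ∀ m → sumFin (coord m) ≡ e₀
coord-sum = from-yes (∀Pt? λ m → sumFin (coord m) ≟G e₀)

form : (Fin 3 → Bool) → Pt → G
form b m = sumFin (λ c → sel (b c) (coord m c))

form-cong : ∀ {b b'} → (∀ c → b c ≡ b' c) → ∀ m → form b m ≡ form b' m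
form-cong e m = sumFin-cong (λ c → cong (λ β → sel β (coord m c)) (e c))

form-⊕ : ∀ b b' m → form b m ⊕ form b' m ≡ form (λ c → b c xor b' c) m
form-⊕ b b' m = trans (sym (sumFin-⊕ (λ c → sel (b c) (coord m c)) (λ c → sel (b' c) (coord m c))))
                      (sumFin-cong (λ c → sel-xor (b c) (b' c) (coord m c)))

-- The two monomials of the binomial: m₁,m₂,m₃ and n₁,n₂,n₃.
ms ns : List Pt
ms = (e₀ , e₀) ∷ (e₁ , e₂) ∷ (e₂ , e₃) ∷ []
ns = (e₀ , e₃) ∷ (e₁ , e₀) ∷ (e₂ , e₂) ∷ []

triple : ∀ {A : Set} → A → A → A → Fin 3 → A
triple x y z fz           = x
triple x y z (fs fz)      = y
triple x y z (fs (fs fz)) = z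

rotate : ∀ {A : Set} (x y z : A) → (x ∷ y ∷ z ∷ []) ↭ (z ∷ x ∷ y ∷ [])
rotate x y z = Perm.trans (Perm.prep x (Perm.swap y z Perm.refl)) (Perm.swap x z Perm.refl)

form-balanced₃ : ∀ x y z → L.map (form (triple x y z)) ms ↭ L.map (form (triple x y z)) ns
form-balanced₃ false false false = ↭-refl
form-balanced₃ true  false false = ↭-refl
form-balanced₃ false true  false = rotate _ _ _
form-balanced₃ false false true  = ↭-sym (rotate _ _ _)
form-balanced₃ true  true  false = ↭-sym (rotate _ _ _)
form-balanced₃ true  false true  = rotate _ _ _
form-balanced₃ false true  true  = ↭-refl
form-balanced₃ true  true  true  = ↭-refl

form-balanced : ∀ b → L.map (form b) ms ↭ L.map (form b) ns
form-balanced b = form-balanced₃ (b fz) (b (fs fz)) (b (fs (fs fz)))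

coord-balanced : ∀ r → L.map (λ m → coord m r) ms ↭ L.map (λ m → coord m r) ns
coord-balanced fz           = form-balanced₃ true  false false
coord-balanced (fs fz)      = form-balanced₃ false true  false
coord-balanced (fs (fs fz)) = form-balanced₃ false false true

other₁ other₂ : Fin 3 → Fin 3
other₁ fz           = fs fz
other₁ (fs fz)      = fz
other₁ (fs (fs fz)) = fz
other₂ fz           = fs (fs fz)
other₂ (fs fz)      = fs (fs fz)
other₂ (fs (fs fz)) = fs fz

-- If a form has equal coefficients at the two indices other than r, then on the
-- plane it only depends on the r-th coordinate (since those two coordinates add
-- up to the r-th one).
pairing₃ : ∀ r x y z → triple x y z (other₁ r) ≡ triple x y z (other₂ r) →
           ∀ m → form (triple x y z) m ≡ sel (triple x y z (other₁ r) xor triple x y z r) (coord m r)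
pairing₃ = from-yes (all? λ r → ∀Bool? λ x → ∀Bool? λ y → ∀Bool? λ z →
  (triple x y z (other₁ r) ≟B triple x y z (other₂ r)) →-dec
  ∀Pt? λ m → form (triple x y z) m ≟G sel (triple x y z (other₁ r) xor triple x y z r) (coord m r))

pairing : ∀ r b → b (other₁ r) ≡ b (other₂ r) →
          ∀ m → form b m ≡ sel (b (other₁ r) xor b r) (coord m r)
pairing fz           b = pairing₃ fz           (b fz) (b (fs fz)) (b (fs (fs fz)))
pairing (fs fz)      b = pairing₃ (fs fz)      (b fz) (b (fs fz)) (b (fs (fs fz)))
pairing (fs (fs fz)) b = pairing₃ (fs (fs fz)) (b fz) (b (fs fz)) (b (fs (fs fz)))

-- The coordinate of 𝔸^{4ⁿ} obtained by putting the coordinates of m at the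
-- leaves u₀, u₁, u₂ (and e₀ at all other leaves).
place : ∀ {n} → (Fin 3 → Fin n) → Pt → Fin n → G
place u m j = form (λ c → does (u c F.≟ j)) m

place-sum : ∀ {n} (u : Fin 3 → Fin n) m → sumFin (place u m) ≡ e₀
place-sum u m = begin
  sumFin (place u m)                            ≡⟨ sumFin-swap δ ⟩
  sumFin (λ c → sumFin (λ j → δ c j))           ≡⟨ sumFin-cong (λ c → sumFin-delta (u c) (coord m c)) ⟩
  sumFin (coord m)                              ≡⟨ coord-sum m ⟩
  e₀                                            ∎
  where
  open P.≡-Reasoning
  δ : Fin 3 → Fin _ → G
  δ c j = sel (does (u c F.≟ j)) (coord m c)

indicator : Bool → ℕ
indicator true  = 1
indicator false = 0

count : ∀ {n} → Fin n → List (Fin n) → ℕ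
count w []      = 0
count w (j ∷ l) = indicator (does (w F.≟ j)) ℕ.+ count w l

count-++ : ∀ {n} (w : Fin n) l l' → count w (l ++ l') ≡ count w l ℕ.+ count w l'
count-++ w []      l' = refl
count-++ w (j ∷ l) l' = trans (cong (indicator (does (w F.≟ j)) ℕ.+_) (count-++ w l l'))
                              (sym (ℕₚ.+-assoc (indicator (does (w F.≟ j))) _ _))

count-↭ : ∀ {n} (w : Fin n) {l l'} → l ↭ l' → count w l ≡ count w l'
count-↭ w Perm.refl         = refl
count-↭ w (Perm.prep j p)   = cong (indicator (does (w F.≟ j)) ℕ.+_) (count-↭ w p)
count-↭ w (Perm.swap {xs} {ys} i j p) = begin
  x ℕ.+ (y ℕ.+ count w xs) ≡⟨ sym (ℕₚ.+-assoc x y _) ⟩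
  (x ℕ.+ y) ℕ.+ count w xs ≡⟨ cong₂ ℕ._+_ (ℕₚ.+-comm x y) (count-↭ w p) ⟩
  (y ℕ.+ x) ℕ.+ count w ys ≡⟨ ℕₚ.+-assoc y x _ ⟩
  y ℕ.+ (x ℕ.+ count w ys) ∎
  where
  open P.≡-Reasoning
  x = indicator (does (w F.≟ i))
  y = indicator (does (w F.≟ j))
count-↭ w (Perm.trans p q)  = trans (count-↭ w p) (count-↭ w q)

sumℕ : ∀ {k} → (Fin k → ℕ) → ℕ
sumℕ = foldr ℕ._+_ 0

count-concat : ∀ {n k} (w : Fin n) (f : Fin k → List (Fin n)) →
               count w (L.concat (L.tabulate f)) ≡ sumℕ (λ v → count w (f v))
count-concat {k = zero}  w f = refl
count-concat {k = suc k} w f =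
  trans (count-++ w (f fz) _) (cong (count w (f fz) ℕ.+_) (count-concat w (λ i → f (fs i))))

count-suc : ∀ {n k} (w : Fin n) (f : Fin k → Fin n) →
            count (fs w) (L.tabulate (λ i → fs (f i))) ≡ count w (L.tabulate f)
count-suc {k = zero}  w f = refl
count-suc {k = suc k} w f = cong (indicator (does (w F.≟ f fz)) ℕ.+_) (count-suc w (λ i → f (fs i)))

count-zero : ∀ {n k} (f : Fin k → Fin n) → count fz (L.tabulate (λ i → fs (f i))) ≡ 0
count-zero {k = zero}  f = refl
count-zero {k = suc k} f = count-zero (λ i → f (fs i))

count-allFin : ∀ {n} (w : Fin n) → count w (L.allFin n) ≡ 1
count-allFin {suc n} fz     = cong suc (count-zero {k = n} (λ i → i))
count-allFin {suc n} (fs w) = trans (count-suc w (λ i → i)) (count-allFin w)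

sumℕ-zero : ∀ {k} (c : Fin k → ℕ) → sumℕ c ≡ 0 → ∀ v → c v ≡ 0
sumℕ-zero c e fz     = ℕₚ.m+n≡0⇒m≡0 (c fz) e
sumℕ-zero c e (fs v) = sumℕ-zero (λ i → c (fs i)) (ℕₚ.m+n≡0⇒n≡0 (c fz) e) v

sumℕ-one : ∀ {k} (c : Fin k → ℕ) → sumℕ c ≡ 1 →
           Σ (Fin k) λ w → ∀ v → c v ≡ indicator (does (w F.≟ v))
sumℕ-one {suc k} c e with c fz in c₀
... | 0 with sumℕ-one (λ i → c (fs i)) e
...   | w , spot = fs w , λ { fz → c₀ ; (fs v) → spot v }
sumℕ-one {suc k} c e | 1 =
  fz , λ { fz → c₀ ; (fs v) → sumℕ-zero (λ i → c (fs i)) (ℕₚ.suc-injective e) v }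

count-trees : ∀ {n k} (N : CycleNet n k) (w : Fin n) → sumℕ (λ v → count w (leaves (tree N v))) ≡ 1
count-trees N w = begin
  sumℕ (λ v → count w (leaves (tree N v)))                  ≡⟨ count-concat w (λ v → leaves (tree N v)) ⟨
  count w (L.concat (L.tabulate (λ v → leaves (tree N v)))) ≡⟨ count-↭ w (bijLeaves N) ⟩
  count w (L.allFin _)                                      ≡⟨ count-allFin w ⟩
  1                                                         ∎
  where open P.≡-Reasoning

-- The cycle vertex whose tree contains a given leaf.
home : ∀ {n k} → CycleNet n k → Fin n → Fin k
home N w = proj₁ (sumℕ-one _ (count-trees N w))

home-count : ∀ {n k} (N : CycleNet n k) (w : Fin n) (v : Fin k) →
             count w (leaves (tree N v)) ≡ indicator (does (home N w F.≟ v))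
home-count N w = proj₂ (sumℕ-one _ (count-trees N w))

odd : ℕ → Bool
odd zero    = false
odd (suc k) = not (odd k)

odd-+ : ∀ a b → odd (a ℕ.+ b) ≡ odd a xor odd b
odd-+ zero    b = refl
odd-+ (suc a) b = trans (cong not (odd-+ a b)) (not-distribˡ-xor (odd a) (odd b))

odd-indicator : ∀ β → odd (indicator β) ≡ β
odd-indicator true  = refl
odd-indicator false = refl

-- bit w t: the parity of the number of occurrences of the leaf w in the tree t;
-- it is the coefficient of the coordinate at w in the split sum of t.
bit : ∀ {n} → Fin n → BTree n → Bool
bit w t = odd (count w (leaves t))

bit-node : ∀ {n} (w : Fin n) l r → bit w (node l r) ≡ bit w l xor bit w r
bit-node w l r = trans (cong odd (count-++ w (leaves l) (leaves r)))
                       (odd-+ (count w (leaves l)) (count w (leaves r)))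

bit-home : ∀ {n k} (N : CycleNet n k) (w : Fin n) (v : Fin k) →
           bit w (tree N v) ≡ does (home N w F.≟ v)
bit-home N w v = trans (cong odd (home-count N w v)) (odd-indicator (does (home N w F.≟ v)))

gsum-place : ∀ {n} (u : Fin 3 → Fin n) (t : BTree n) m → gsum t (place u m) ≡ form (λ c → bit (u c) t) m
gsum-place u (leaf j)   m = form-cong (λ c → sym (bit-leaf c)) m
  where
  bit-leaf : ∀ c → bit (u c) (leaf j) ≡ does (u c F.≟ j)
  bit-leaf c = trans (cong odd (ℕₚ.+-identityʳ (indicator (does (u c F.≟ j))))) (odd-indicator _)
gsum-place u (node l r) m = begin
  gsum l (place u m) ⊕ gsum r (place u m)   ≡⟨ cong₂ _⊕_ (gsum-place u l m) (gsum-place u r m) ⟩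
  form bₗ m ⊕ form bᵣ m                     ≡⟨ form-⊕ bₗ bᵣ m ⟩
  form (λ c → bₗ c xor bᵣ c) m              ≡⟨ form-cong (λ c → sym (bit-node (u c) l r)) m ⟩
  form (λ c → bit (u c) (node l r)) m       ∎
  where
  open P.≡-Reasoning
  bₗ bᵣ : Fin 3 → Bool
  bₗ c = bit (u c) l
  bᵣ c = bit (u c) r

-- The leftmost leaf of a tree serves as representative of the tree.
leftmost : ∀ {n} → BTree n → Fin n
leftmost (leaf j)   = j
leftmost (node l r) = leftmost l

count-leftmost : ∀ {n} (t : BTree n) → 1 ≤ count (leftmost t) (leaves t)
count-leftmost (leaf j) rewrite dec-true (j F.≟ j) refl = s≤s z≤n
count-leftmost (node l r) = begin
  1                                    ≤⟨ count-leftmost l ⟩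
  count w (leaves l)                   ≤⟨ ℕₚ.m≤m+n _ _ ⟩
  count w (leaves l) ℕ.+ count w (leaves r) ≡⟨ count-++ w (leaves l) (leaves r) ⟨
  count w (leaves l ++ leaves r)       ∎
  where
  open ℕₚ.≤-Reasoning
  w = leftmost l

home-leftmost : ∀ {n k} (N : CycleNet n k) (i : Fin k) → home N (leftmost (tree N i)) ≡ i
home-leftmost N i with home N (leftmost (tree N i)) F.≟ i | home-count N (leftmost (tree N i)) i
... | yes h≡i | _   = h≡i
... | no _    | c≡0 = contradiction (subst (1 ≤_) c≡0 (count-leftmost (tree N i))) λ ()

inT₁ inT₂ : ∀ {k} → Fin k → Fin k → Bool
inT₁ j v = (1 ≤ᵇ toℕ v) ∧ (toℕ v ≤ᵇ toℕ j)
inT₂ j v = toℕ v ≤ᵇ toℕ j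

sumWhere : ∀ {k} → (Fin k → Bool) → (Fin k → G) → G
sumWhere b f = sumFin (λ v → if b v then f v else e₀)

split₁? : ∀ {k} (cut : Fin k) (host : Fin 3 → Fin k) →
          Dec (∀ m → sumWhere (inT₁ cut) (place host m) ≡ coord m (# 1))
split₁? cut host = ∀Pt? λ m → sumWhere (inT₁ cut) (place host m) ≟G coord m (# 1)
split₂? : ∀ {k} (cut : Fin k) (host : Fin 3 → Fin k) →
          Dec (∀ m → sumWhere (inT₂ cut) (place host m) ≡ coord m (# 2))
split₂? cut host = ∀Pt? λ m → sumWhere (inT₂ cut) (place host m) ≟G coord m (# 2)

-- A witness in a k-cycle network: an inner cycle edge 'cut' (present in both
-- T₁ and T₂) and three cycle vertices 'host' whose trees receive the three
-- coordinates, such that the splits of 'cut' in T₁ and T₂ see exactly the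
-- coordinates g₁ and g₂ of a placed point.
record Witness (k : ℕ) : Set where
  field
    cut    : Fin k
    host   : Fin 3 → Fin k
    inner₁ : (toℕ cut ℕ.≡ᵇ 0) ≡ false
    inner₂ : (suc (toℕ cut) ℕ.≡ᵇ k) ≡ false
    split₁ : ∀ m → sumWhere (inT₁ cut) (place host m) ≡ coord m (# 1)
    split₂ : ∀ m → sumWhere (inT₂ cut) (place host m) ≡ coord m (# 2)

open Witness public

Hosted : ∀ {k} → Witness k → Fin 3 → Fin k → Fin k → Set
Hosted W r i j = host W (other₁ r) ≡ i × host W (other₂ r) ≡ j

Coverage : ℕ → Set
Coverage k = ∀ (i j : Fin k) → i F.< j → Σ (Witness k) λ W → Σ (Fin 3) λ r → Hosted W r i j

witness : ∀ {k} (cut : Fin k) (host : Fin 3 → Fin k) →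
          (toℕ cut ℕ.≡ᵇ 0) ≡ false → (suc (toℕ cut) ℕ.≡ᵇ k) ≡ false →
          {True (split₁? cut host)} → {True (split₂? cut host)} → Witness k
witness cut host inner₁ inner₂ {s₁} {s₂} = record
  { cut = cut ; host = host ; inner₁ = inner₁ ; inner₂ = inner₂
  ; split₁ = toWitness s₁ ; split₂ = toWitness s₂ }

W₃ : Witness 3
W₃ = witness (# 1) (triple (# 0) (# 1) (# 2)) refl refl

W₀₁₂ W₀₁₃ W₀₂₃ : Witness 4
W₀₁₂ = witness (# 1) (triple (# 0) (# 1) (# 2)) refl refl
W₀₁₃ = witness (# 1) (triple (# 0) (# 1) (# 3)) refl refl
W₀₂₃ = witness (# 2) (triple (# 0) (# 2) (# 3)) refl refl

cover₃ : Coverage 3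
cover₃ fz      (fs fz)      _ = W₃ , # 2 , refl , refl
cover₃ fz      (fs (fs fz)) _ = W₃ , # 1 , refl , refl
cover₃ (fs fz) (fs (fs fz)) _ = W₃ , # 0 , refl , refl
cover₃ (fs _)      (fs fz)      (s≤s ())
cover₃ (fs (fs _)) (fs (fs fz)) (s≤s (s≤s ()))

cover₄ : Coverage 4
cover₄ fz           (fs fz)           _ = W₀₁₂ , # 2 , refl , refl
cover₄ fz           (fs (fs fz))      _ = W₀₁₂ , # 1 , refl , refl
cover₄ fz           (fs (fs (fs fz))) _ = W₀₁₃ , # 1 , refl , refl
cover₄ (fs fz)      (fs (fs fz))      _ = W₀₁₂ , # 0 , refl , refl
cover₄ (fs fz)      (fs (fs (fs fz))) _ = W₀₁₃ , # 0 , refl , refl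
cover₄ (fs (fs fz)) (fs (fs (fs fz))) _ = W₀₂₃ , # 0 , refl , refl
cover₄ (fs _)           (fs fz)           (s≤s ())
cover₄ (fs (fs _))      (fs (fs fz))      (s≤s (s≤s ()))
cover₄ (fs (fs (fs _))) (fs (fs (fs fz))) (s≤s (s≤s (s≤s ())))

coverage : ∀ {k₁ k₂} → 2 ≤ k₁ → k₁ < k₂ → k₂ ≤ 4 → Coverage k₂
coverage {k₂ = 3} _ _ _ = cover₃
coverage {k₂ = 4} _ _ _ = cover₄
coverage {k₂ = suc (suc (suc (suc (suc _))))} _ _ (s≤s (s≤s (s≤s (s≤s ()))))
coverage {k₂ = 0} _ () _
coverage {k₂ = 1} (s≤s (s≤s _)) (s≤s ()) _
coverage {k₂ = 2} (s≤s (s≤s _)) (s≤s (s≤s ())) _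

treeSums : ∀ {n k} → CycleNet n k → (Fin n → G) → Fin k → G
treeSums N g v = gsum (tree N v) g

hostLeaves : ∀ {n k} → CycleNet n k → Witness k → Fin 3 → Fin n
hostLeaves N W c = leftmost (tree N (host W c))

treeSums-host : ∀ {n k} (N : CycleNet n k) (W : Witness k) m v →
                treeSums N (place (hostLeaves N W) m) v ≡ place (host W) m v
treeSums-host N W m v = trans (gsum-place (hostLeaves N W) (tree N v) m) (form-cong hosted m)
  where
  hosted : ∀ c → bit (hostLeaves N W c) (tree N v) ≡ does (host W c F.≟ v)
  hosted c = trans (bit-home N (hostLeaves N W c) v) (cong (λ h → does (h F.≟ v)) (home-leftmost N (host W c)))

module _ (R : CommutativeRing 0ℓ 0ℓ) where
  open CommutativeRing R renaming (refl to ≈-refl; sym to ≈-sym; trans to ≈-trans)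
  open Poly R
  open import Algebra.Properties.CommutativeSemigroup *-commutativeSemigroup using (x∙yz≈y∙xz; interchange)
  open import Algebra.Properties.Ring ring using (-1*x≈-x)
  open import Algebra.Properties.Group +-group using (x∙y⁻¹≈ε⇒x≈y; x≈y⇒x∙y⁻¹≈ε; ∙-cancelˡ)
  open import Data.List.Relation.Binary.Permutation.Propositional using (↭⇒↭ₛ′)
  open import Data.List.Relation.Binary.Permutation.Propositional.Properties using (map⁺)
  open import Data.List.Relation.Binary.Permutation.Setoid.Properties setoid using (foldr-commMonoid)
  import Relation.Binary.Reasoning.Setoid setoid as ≈-Reasoning

  ∏ : List Carrier → Carrier
  ∏ = L.foldr _*_ 1#

  -- F is balanced when ∏_{m ∈ ms} F m ≈ ∏_{m ∈ ns} F m, i.e. the binomial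
  -- vanishes at the point whose placed coordinates are given by F.
  record Balanced (F : Pt → Carrier) : Set where
    constructor balanced
    field balance : ∏ (L.map F ms) ≈ ∏ (L.map F ns)

  balanced-via : (H : G → Carrier) (φ : Pt → G) → L.map φ ms ↭ L.map φ ns → Balanced (λ m → H (φ m))
  balanced-via H φ p = balanced $ foldr-commMonoid *-isCommutativeMonoid (↭⇒↭ₛ′ isEquivalence (map⁺ H p))

  Balanced-cong : ∀ {F F' : Pt → Carrier} → (∀ m → F m ≈ F' m) → Balanced F' → Balanced F
  Balanced-cong {F} {F'} F≈F' (balanced bal) =
    balanced $ ≈-trans (∏-cong ms) (≈-trans bal (≈-sym (∏-cong ns)))
    where
    ∏-cong : ∀ l → ∏ (L.map F l) ≈ ∏ (L.map F' l)
    ∏-cong []      = ≈-refl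
    ∏-cong (m ∷ l) = *-cong (F≈F' m) (∏-cong l)

  Balanced-* : ∀ {F F' : Pt → Carrier} → Balanced F → Balanced F' → Balanced (λ m → F m * F' m)
  Balanced-* {F} {F'} (balanced bal) (balanced bal') =
    balanced $ ≈-trans (∏-* ms) (≈-trans (*-cong bal bal') (≈-sym (∏-* ns)))
    where
    ∏-* : ∀ l → ∏ (L.map (λ m → F m * F' m) l) ≈ ∏ (L.map F l) * ∏ (L.map F' l)
    ∏-* []      = ≈-sym (*-identityˡ 1#)
    ∏-* (m ∷ l) = ≈-trans (*-congˡ (∏-* l)) (interchange (F m) (F' m) _ _)

  Balanced-prodFin : ∀ {k} (F : Fin k → Pt → Carrier) → (∀ i → Balanced (F i)) →
                     Balanced (λ m → prodFin (λ i → F i m))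
  Balanced-prodFin {zero}  F bal = balanced ≈-refl
  Balanced-prodFin {suc k} F bal = Balanced-* (bal fz) (Balanced-prodFin (λ i → F (fs i)) (λ i → bal (fs i)))

  -- All tree parts of ψ_N are balanced: each edge is evaluated at a linear form.
  module _ {n} (u : Fin 3 → Fin n) where

    Balanced-edge : (H : G → Carrier) (t : BTree n) → Balanced (λ m → H (gsum t (place u m)))
    Balanced-edge H t = Balanced-cong (λ m → reflexive (cong H (gsum-place u t m)))
                                      (balanced-via H (form (λ c → bit (u c) t)) (form-balanced (λ c → bit (u c) t)))

    Balanced-prodT : (t : BTree n) (p : TEdge t → G → Carrier) → Balanced (λ m → prodT t p (place u m))
    Balanced-prodT (leaf j)   p = balanced ≈-refl
    Balanced-prodT (node l r) p =
      Balanced-* (Balanced-* (Balanced-* (Balanced-edge (p toL) l) (Balanced-edge (p toR) r))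
                             (Balanced-prodT l (λ e → p (inL e))))
                 (Balanced-prodT r (λ e → p (inR e)))

    Balanced-prodTrees : ∀ {k} (N : CycleNet n k) (a : Params N) → Balanced (λ m → prodTrees N a (place u m))
    Balanced-prodTrees N a = Balanced-prodFin _ λ i →
      Balanced-* (Balanced-edge (a (pend i)) (tree N i)) (Balanced-prodT (tree N i) (λ e → a (int i e)))

  -- The cycle factors of ψ_{T₁}, ψ_{T₂} as functions of the tree sums Γ of a
  -- network: cycFactor₁ N a g is by definition cycleFactor₁ (a ∘ cyc) (treeSums N g).
  cycleFactor₁ cycleFactor₂ : ∀ {k} → (Fin k → G → Carrier) → (Fin k → G) → Carrier
  cycleFactor₁ A Γ = prodFin (λ j → if toℕ j ℕ.≡ᵇ 0 then 1# else A j (sumWhere (inT₁ j) Γ))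
  cycleFactor₂ {k} A Γ = prodFin (λ j → if suc (toℕ j) ℕ.≡ᵇ k then 1# else A j (sumWhere (inT₂ j) Γ))

  mixture : ∀ {k} → Carrier → (Fin k → G → Carrier) → (Fin k → G) → Carrier
  mixture λ' A Γ = λ' * cycleFactor₁ A Γ + (1# - λ') * cycleFactor₂ A Γ

  mixture-cong : ∀ {k} λ' (A : Fin k → G → Carrier) {Γ Γ' : Fin k → G} →
                 (∀ v → Γ v ≡ Γ' v) → mixture λ' A Γ ≡ mixture λ' A Γ'
  mixture-cong {k} λ' A {Γ} {Γ'} e = cong₂ (λ x y → λ' * x + (1# - λ') * y)
    (prodFin-cong (λ j → cong (λ s → if toℕ j ℕ.≡ᵇ 0 then 1# else A j s) (sumWhere-cong (inT₁ j))))
    (prodFin-cong (λ j → cong (λ s → if suc (toℕ j) ℕ.≡ᵇ k then 1# else A j s) (sumWhere-cong (inT₂ j))))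
    where
    sumWhere-cong : ∀ b → sumWhere b Γ ≡ sumWhere b Γ'
    sumWhere-cong b = sumFin-cong (λ v → cong (λ g → if b v then g else e₀) (e v))
    prodFin-cong : ∀ {l} {F F' : Fin l → Carrier} → (∀ j → F j ≡ F' j) → prodFin F ≡ prodFin F'
    prodFin-cong {zero}  e = refl
    prodFin-cong {suc l} e = cong₂ _*_ (e fz) (prodFin-cong (λ j → e (fs j)))

  ψN-factor : ∀ {n k} (N : CycleNet n k) (a : Params N) λ' g → sumFin g ≡ e₀ →
              ψN N a λ' g ≈ prodTrees N a g * mixture λ' (λ j → a (cyc j)) (treeSums N g)
  ψN-factor N a λ' g g∈ker rewrite g∈ker =
    ≈-trans (+-cong (x∙yz≈y∙xz _ _ _) (x∙yz≈y∙xz _ _ _)) (≈-sym (distribˡ _ _ _))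

  -- (1) If the leaves u at the positions other than r lie in one tree of N, the
  -- binomial vanishes on the image of ψ_N: the tree sums only see the r-th
  -- coordinate, so the cycle part is balanced via coord-balanced.
  balanced-on-network : ∀ {n k} (N : CycleNet n k) (u : Fin 3 → Fin n) (r : Fin 3) →
                        home N (u (other₁ r)) ≡ home N (u (other₂ r)) →
                        ∀ (a : Params N) λ' → Balanced (λ m → ψN N a λ' (place u m))
  balanced-on-network {k = k} N u r same a λ' =
    Balanced-cong (λ m → ψN-factor N a λ' (place u m) (place-sum u m))
                  (Balanced-* (Balanced-prodTrees u N a) mixture-balanced)
    where
    A : Fin k → G → Carrier
    A j = a (cyc j)
    paired : ∀ v → bit (u (other₁ r)) (tree N v) ≡ bit (u (other₂ r)) (tree N v)
    paired v = trans (bit-home N (u (other₁ r)) v)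
                     (trans (cong (λ h → does (h F.≟ v)) same) (sym (bit-home N (u (other₂ r)) v)))
    β : Fin k → Bool
    β v = bit (u (other₁ r)) (tree N v) xor bit (u r) (tree N v)
    treeSums-paired : ∀ m v → treeSums N (place u m) v ≡ sel (β v) (coord m r)
    treeSums-paired m v = trans (gsum-place u (tree N v) m)
                                (pairing r (λ c → bit (u c) (tree N v)) (paired v) m)
    mixture-balanced : Balanced (λ m → mixture λ' A (treeSums N (place u m)))
    mixture-balanced =
      Balanced-cong (λ m → reflexive (mixture-cong λ' A (treeSums-paired m)))
                    (balanced-via (λ y → mixture λ' A (λ v → sel (β v) y)) (λ m → coord m r) (coord-balanced r))

  monomial : ∀ {n} → (Fin 3 → Fin n) → List Pt → Pol (Coord n)
  monomial u []      = con 1#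
  monomial u (m ∷ l) = var (place u m) :* monomial u l

  binomial : ∀ {n} → (Fin 3 → Fin n) → Pol (Coord n)
  binomial u = monomial u ms :+ (con (- 1#) :* monomial u ns)

  eval-binomial : ∀ {n} (u : Fin 3 → Fin n) (x : Point n) →
                  eval (binomial u) x ≈ ∏ (L.map (λ m → x (place u m)) ms) - ∏ (L.map (λ m → x (place u m)) ns)
  eval-binomial u x = +-congˡ (-1*x≈-x _)

  balanced⇒binomial≈0 : ∀ {n} (u : Fin 3 → Fin n) (x : Point n) →
                        Balanced (λ m → x (place u m)) → eval (binomial u) x ≈ 0#
  balanced⇒binomial≈0 u x (balanced bal) = ≈-trans (eval-binomial u x) (x≈y⇒x∙y⁻¹≈ε bal)

  binomial≈0⇒balanced : ∀ {n} (u : Fin 3 → Fin n) (x : Point n) →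
                        eval (binomial u) x ≈ 0# → Balanced (λ m → x (place u m))
  binomial≈0⇒balanced u x f≈0 = balanced (x∙y⁻¹≈ε⇒x≈y _ _ (≈-trans (≈-sym (eval-binomial u x)) f≈0))

  φ : G → Carrier
  φ g = if isZero g then 0# else 1#

  φ-nonzero : ∀ {h} → h ≢ e₀ → φ h ≡ 1#
  φ-nonzero {e₀} h≢0 = contradiction refl h≢0
  φ-nonzero {e₁} _   = refl
  φ-nonzero {e₂} _   = refl
  φ-nonzero {e₃} _   = refl

  -- (2) The probe parameters of a witness: φ on the cut edge, 1 everywhere else.
  -- φ is constant on non-identity elements, so they are K2P-admissible.
  probeEdge : ∀ {k} → Fin k → Fin k → G → Carrier
  probeEdge c j g = if does (j F.≟ c) then φ g else 1#

  probe : ∀ {n k} {N : CycleNet n k} → Witness k → Params N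
  probe W (cyc j)   g = probeEdge (cut W) j g
  probe W (pend _)  _ = 1#
  probe W (int _ _) _ = 1#

  probe-admissible : ∀ {n k} {N : CycleNet n k} M (W : Witness k) → Admissible {N = N} M (probe W)
  probe-admissible K3P W = tt
  probe-admissible (K2P h₁ h₂ _ h₁≢0 h₂≢0) W (cyc j) with does (j F.≟ cut W)
  ... | true  = reflexive (trans (φ-nonzero h₁≢0) (sym (φ-nonzero h₂≢0)))
  ... | false = ≈-refl
  probe-admissible (K2P _ _ _ _ _) W (pend _)  = ≈-refl
  probe-admissible (K2P _ _ _ _ _) W (int _ _) = ≈-refl

  prodFin-one : ∀ {k} (F : Fin k → Carrier) → (∀ j → F j ≈ 1#) → prodFin F ≈ 1#
  prodFin-one {zero}  F one = ≈-refl
  prodFin-one {suc k} F one =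
    ≈-trans (*-cong (one fz) (prodFin-one (λ j → F (fs j)) (λ j → one (fs j)))) (*-identityˡ 1#)

  prodFin-single : ∀ {k} (F : Fin k → Carrier) (i : Fin k) → (∀ j → j ≢ i → F j ≈ 1#) → prodFin F ≈ F i
  prodFin-single {suc k} F fz     one =
    ≈-trans (*-congˡ (prodFin-one (λ j → F (fs j)) (λ j → one (fs j) λ ()))) (*-identityʳ (F fz))
  prodFin-single {suc k} F (fs i) one =
    ≈-trans (*-cong (one fz λ ())
                    (prodFin-single (λ j → F (fs j)) i (λ j j≢i → one (fs j) (j≢i ∘ suc-injective))))
            (*-identityˡ (F (fs i)))

  prodT-one : ∀ {n} (t : BTree n) (p : TEdge t → G → Carrier) g → (∀ e h → p e h ≈ 1#) → prodT t p g ≈ 1#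
  prodT-one (leaf j)   p g one = ≈-refl
  prodT-one (node l r) p g one = begin
    p toL _ * p toR _ * prodT l _ g * prodT r _ g ≈⟨ *-cong (*-cong (*-cong (one toL _) (one toR _))
                                                              (prodT-one l _ g (λ e → one (inL e))))
                                                      (prodT-one r _ g (λ e → one (inR e))) ⟩
    1# * 1# * 1# * 1#                             ≈⟨ *-congʳ (*-congʳ (*-identityʳ 1#)) ⟩
    1# * 1# * 1#                                  ≈⟨ *-congʳ (*-identityʳ 1#) ⟩
    1# * 1#                                       ≈⟨ *-identityʳ 1# ⟩
    1#                                            ∎
    where open ≈-Reasoning

  probe-cycleFactor : ∀ {k} (c : Fin k) (guard : Fin k → Bool) (s : Fin k → G) → guard c ≡ false →
                      prodFin (λ j → if guard j then 1# else probeEdge c j (s j)) ≈ φ (s c)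
  probe-cycleFactor c guard s guard≡false = ≈-trans (prodFin-single _ c off) (reflexive on)
    where
    off : ∀ j → j ≢ c → (if guard j then 1# else probeEdge c j (s j)) ≈ 1#
    off j j≢c rewrite dec-false (j F.≟ c) j≢c with guard j
    ... | true  = ≈-refl
    ... | false = ≈-refl
    on : (if guard c then 1# else probeEdge c c (s c)) ≡ φ (s c)
    on rewrite guard≡false | dec-true (c F.≟ c) refl = refl

  probe-value : ∀ {n k} (N : CycleNet n k) (W : Witness k) λ' m →
                ψN N (probe W) λ' (place (hostLeaves N W) m) ≈ λ' * φ (coord m (# 1)) + (1# - λ') * φ (coord m (# 2))
  probe-value {k = k} N W λ' m = begin
    ψN N (probe W) λ' g
      ≈⟨ ψN-factor N (probe W) λ' g (place-sum (hostLeaves N W) m) ⟩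
    prodTrees N (probe W) g * mixture λ' A (treeSums N g)
      ≈⟨ *-cong trees-one (reflexive (mixture-cong λ' A (treeSums-host N W m))) ⟩
    1# * mixture λ' A (place (host W) m)
      ≈⟨ *-identityˡ _ ⟩
    mixture λ' A (place (host W) m)
      ≈⟨ +-cong (*-congˡ cycle₁) (*-congˡ cycle₂) ⟩
    λ' * φ (coord m (# 1)) + (1# - λ') * φ (coord m (# 2)) ∎
    where
    open ≈-Reasoning
    g = place (hostLeaves N W) m
    A = probeEdge (cut W)
    trees-one : prodTrees N (probe W) g ≈ 1#
    trees-one = prodFin-one _ (λ i → ≈-trans (*-identityˡ _) (prodT-one (tree N i) _ g (λ _ _ → ≈-refl)))
    cycle₁ : cycleFactor₁ A (place (host W) m) ≈ φ (coord m (# 1))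
    cycle₁ = ≈-trans (probe-cycleFactor (cut W) (λ j → toℕ j ℕ.≡ᵇ 0)
                                        (λ j → sumWhere (inT₁ j) (place (host W) m)) (inner₁ W))
                     (reflexive (cong φ (split₁ W m)))
    cycle₂ : cycleFactor₂ A (place (host W) m) ≈ φ (coord m (# 2))
    cycle₂ = ≈-trans (probe-cycleFactor (cut W) (λ j → suc (toℕ j) ℕ.≡ᵇ k)
                                        (λ j → sumWhere (inT₂ j) (place (host W) m)) (inner₂ W))
                     (reflexive (cong φ (split₂ W m)))

  module _ (acf : IsACF0 R) where
    open IsACF0 acf using (nontrivial; inverse; charZero)

    nonzero-* : ∀ {x y} → ¬ x ≈ 0# → ¬ y ≈ 0# → ¬ (x * y) ≈ 0#
    nonzero-* {x} {y} x≉0 y≉0 xy≈0 with inverse x x≉0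
    ... | x⁻¹ , xx⁻¹≈1 = y≉0 $ begin
      y             ≈⟨ *-identityˡ y ⟨
      1# * y        ≈⟨ *-congʳ xx⁻¹≈1 ⟨
      (x * x⁻¹) * y ≈⟨ *-congʳ (*-comm x x⁻¹) ⟩
      (x⁻¹ * x) * y ≈⟨ *-assoc x⁻¹ x y ⟩
      x⁻¹ * (x * y) ≈⟨ *-congˡ xy≈0 ⟩
      x⁻¹ * 0#      ≈⟨ zeroʳ x⁻¹ ⟩
      0#            ∎
      where open ≈-Reasoning

    nonzero-resp : ∀ {x y} → x ≈ y → ¬ y ≈ 0# → ¬ x ≈ 0#
    nonzero-resp x≈y y≉0 x≈0 = y≉0 (≈-trans (≈-sym x≈y) x≈0)

    -- For λ ∉ {0, 1} the probe point is not balanced: its value at m₁ is 0 while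
    -- its values at n₁, n₂, n₃ are 1, 1 − λ and λ.
    probe-separates : ∀ {n k} (N : CycleNet n k) (W : Witness k) {λ'} → ¬ λ' ≈ 0# → ¬ (1# - λ') ≈ 0# →
                      ¬ Balanced (λ m → ψN N (probe W) λ' (place (hostLeaves N W) m))
    probe-separates N W {λ'} λ≉0 1-λ≉0 (balanced bal) = ∏ns≉0 (≈-trans (≈-sym bal) ∏ms≈0)
      where
      x : Pt → Carrier
      x m = ψN N (probe W) λ' (place (hostLeaves N W) m)
      x-m₁ : x (e₀ , e₀) ≈ 0#
      x-m₁ = ≈-trans (probe-value N W λ' (e₀ , e₀))
                     (≈-trans (+-cong (zeroʳ λ') (zeroʳ (1# - λ'))) (+-identityʳ 0#))
      x-n₁ : x (e₀ , e₃) ≈ 1#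
      x-n₁ = begin
        x (e₀ , e₃)                 ≈⟨ probe-value N W λ' (e₀ , e₃) ⟩
        λ' * 1# + (1# - λ') * 1#    ≈⟨ +-cong (*-identityʳ λ') (*-identityʳ (1# - λ')) ⟩
        λ' + (1# - λ')              ≈⟨ +-congˡ (+-comm 1# (- λ')) ⟩
        λ' + (- λ' + 1#)            ≈⟨ +-assoc λ' (- λ') 1# ⟨
        (λ' - λ') + 1#              ≈⟨ +-congʳ (-‿inverseʳ λ') ⟩
        0# + 1#                     ≈⟨ +-identityˡ 1# ⟩
        1#                          ∎
        where open ≈-Reasoning
      x-n₂ : x (e₁ , e₀) ≈ 1# - λ'
      x-n₂ = ≈-trans (probe-value N W λ' (e₁ , e₀))
                     (≈-trans (+-cong (zeroʳ λ') (*-identityʳ (1# - λ'))) (+-identityˡ (1# - λ')))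
      x-n₃ : x (e₂ , e₂) ≈ λ'
      x-n₃ = ≈-trans (probe-value N W λ' (e₂ , e₂))
                     (≈-trans (+-cong (*-identityʳ λ') (zeroʳ (1# - λ'))) (+-identityʳ λ'))
      ∏ms≈0 : ∏ (L.map x ms) ≈ 0#
      ∏ms≈0 = ≈-trans (*-congʳ x-m₁) (zeroˡ _)
      ∏ns≉0 : ¬ ∏ (L.map x ns) ≈ 0#
      ∏ns≉0 = nonzero-* (nonzero-resp x-n₁ nontrivial)
              (nonzero-* (nonzero-resp x-n₂ 1-λ≉0)
              (nonzero-* (nonzero-resp x-n₃ λ≉0) nontrivial))

    -- λ = 2 is admissible since the characteristic is zero.
    two : Carrier
    two = 1# + 1#

    two≉0 : ¬ two ≈ 0#
    two≉0 two≈0 = charZero 1 (≈-trans (+-congˡ (+-identityʳ 1#)) two≈0)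

    1-two≉0 : ¬ (1# - two) ≈ 0#
    1-two≉0 1-two≈0 = nontrivial (≈-sym (∙-cancelˡ 1# 0# 1# 1+0≈1+1))
      where
      1+0≈1+1 : 1# + 0# ≈ 1# + 1#
      1+0≈1+1 = ≈-trans (+-identityʳ 1#) (x∙y⁻¹≈ε⇒x≈y 1# two 1-two≈0)

    separation : ∀ {n k₁ k₂} M (N₁ : CycleNet n k₁) (N₂ : CycleNet n k₂) (W : Witness k₂) (r : Fin 3) →
                 home N₁ (hostLeaves N₂ W (other₁ r)) ≡ home N₁ (hostLeaves N₂ W (other₂ r)) →
                 ¬ (∀ (x : Point n) → x ∈V[ M , N₂ ] → x ∈V[ M , N₁ ])
    separation M N₁ N₂ W r same V₂⊆V₁ =
      probe-separates N₂ W two≉0 1-two≉0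
        (binomial≈0⇒balanced u x (V₂⊆V₁ x x∈V₂ (binomial u) vanishes-on-N₁))
      where
      u : Fin 3 → Fin _
      u = hostLeaves N₂ W
      x : Point _
      x = ψN N₂ (probe W) two
      x∈V₂ : x ∈V[ M , N₂ ]
      x∈V₂ f vanishes-on-N₂ = vanishes-on-N₂ (probe W) (probe-admissible M W) two
      vanishes-on-N₁ : ∀ (a : Params N₁) → Admissible M a → ∀ λ' → eval (binomial u) (ψN N₁ a λ') ≈ 0#
      vanishes-on-N₁ a _ λ' = balanced⇒binomial≈0 u (ψN N₁ a λ') (balanced-on-network N₁ u r same a λ')

-- (3) Pigeonhole gives two trees of N₂ whose leftmost leaves share a tree of
-- N₁; a witness hosts them, and separation applies.
lemma5p7 : (R : CommutativeRing 0ℓ 0ℓ) → IsACF0 R →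
           (M : Model) (n k₁ k₂ : ℕ) → 2 ≤ k₁ → k₁ < k₂ → k₂ ≤ 4 →
           (N₁ : CycleNet n k₁) (N₂ : CycleNet n k₂) →
           ¬ (∀ (x : Poly.Point R n) → Poly._∈V[_,_] R x M N₂ → Poly._∈V[_,_] R x M N₁)
lemma5p7 R acf M n k₁ k₂ 2≤k₁ k₁<k₂ k₂≤4 N₁ N₂ =
  let (i , j , i<j , same) = pigeonhole k₁<k₂ homeOf
      (W , r , host₁≡i , host₂≡j) = coverage 2≤k₁ k₁<k₂ k₂≤4 i j i<j
  in separation R acf M N₁ N₂ W r
       (trans (cong homeOf host₁≡i) (trans same (sym (cong homeOf host₂≡j))))
  where
  homeOf : Fin k₂ → Fin k₁
  homeOf v = home N₁ (leftmost (tree N₂ v))
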